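{- For every integer $k \geq 3$, every graph in $\mathcal{H}_k$ is strongly chordal.
   Context: For an integer $k \geq 1$, $G_k := K_k \vee P_{2k+1}$ is the join of a complete graph on vertices $x_1, \ldots, x_k$ with a path on $2k+1$ vertices whose vertices, in order along the path, are $u_1, u_2, \ldots, u_k, z, v_k, v_{k-1}, \ldots, v_1$ (every $x_i$ is adjacent to every path vertex and to every other $x_j$). The heavy edges of $G_k$ are $A_k = \{x_iu_i : 1 \leq i \leq k\} \cup \{x_iv_i : 1 \leq i \leq k-1\}$. Pasting a clique of order $r \geq 3$ onto an edge $ab$ means adding $r-2$ new vertices that are pairwise adjacent and each adjacent to both $a$ and $b$ (so $a$, $b$ and the new vertices form a clique of order $r$). $\mathcal{H}_k$ is the family of all graphs obtained from $G_k$ by pasting, onto each heavy edge in $A_k$, a clique (of any order at least $3$, possibly different for different edges), the new vertices for different heavy edges being distinct. A graph is chordal if it has no induced cycle of length at least $4$; it is strongly chordal if it is chordal and every even cycle of length at least $6$ has a chord joining two vertices at odd distance from each other along the cycle. -}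

module Defs where

open import Data.Nat using (ℕ; zero; suc; _+_; _*_; _∸_; _≤_; _<_; ∣_-_∣; _%_)
open import Data.Fin using (Fin; toℕ)
open import Data.Product using (Σ; _×_; _,_)
open import Data.Sum using (_⊎_)
open import Relation.Binary.PropositionalEquality using (_≡_; _≢_)
open import Relation.Nullary using (¬_)
open import Function.Definitions using (Injective)

CycNb : (m : ℕ) → Fin m → Fin m → Set
CycNb m i j = (suc (toℕ i) ≡ toℕ j) ⊎ ((suc (toℕ i) ≡ m) × (toℕ j ≡ 0))

IsCycle : {V : Set} (Adj : V → V → Set) (m : ℕ) (f : Fin m → V) → Set
IsCycle Adj m f = Injective _≡_ _≡_ f × (∀ i j → CycNb m i j → Adj (f i) (f j))

IsChord : {V : Set} (Adj : V → V → Set) (m : ℕ) (f : Fin m → V) → Fin m → Fin m → Set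
IsChord Adj m f i j = (i ≢ j) × ¬ CycNb m i j × ¬ CycNb m j i × Adj (f i) (f j)

Chordal : {V : Set} (Adj : V → V → Set) → Set
Chordal {V} Adj =
  ¬ (Σ ℕ λ m → Σ (Fin m → V) λ f →
       (4 ≤ m) × IsCycle Adj m f × (∀ i j → ¬ IsChord Adj m f i j))

-- Odd chord: a chord joining two vertices at odd distance along the cycle
-- (for an even cycle the parity of |i - j| is the parity of the distance).
IsOddChord : {V : Set} (Adj : V → V → Set) (m : ℕ) (f : Fin m → V) → Fin m → Fin m → Set
IsOddChord Adj m f i j = IsChord Adj m f i j × (∣ toℕ i - toℕ j ∣ % 2 ≡ 1)

StronglyChordal : {V : Set} (Adj : V → V → Set) → Set
StronglyChordal {V} Adj =
  Chordal Adj ×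
  (∀ (m : ℕ) (f : Fin m → V) → 6 ≤ m → m % 2 ≡ 0 → IsCycle Adj m f →
     Σ (Fin m) λ i → Σ (Fin m) λ j → IsOddChord Adj m f i j)

-- Indices are 0-based: x i, u i, v i for i : Fin k
-- stand for x_{i+1}, u_{i+1}, v_{i+1}.
-- r i  : order of the clique pasted on the heavy edge x_{i+1} u_{i+1}
--        (new vertices: Fin (r i ∸ 2)),
-- s j  : order of the clique pasted on the heavy edge x_{j+1} v_{j+1},
--        j : Fin (k ∸ 1)  (i.e. 1 ≤ j+1 ≤ k-1).

data HV (k : ℕ) (r : Fin k → ℕ) (s : Fin (k ∸ 1) → ℕ) : Set where
  x  : Fin k → HV k r s
  u  : Fin k → HV k r s
  z  : HV k r s
  v  : Fin k → HV k r s
  cu : (i : Fin k) → Fin (r i ∸ 2) → HV k r s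
  cv : (j : Fin (k ∸ 1)) → Fin (s j ∸ 2) → HV k r s

data IsPathVertex {k r s} : HV k r s → Set where
  pu : ∀ i → IsPathVertex (u i)
  pz : IsPathVertex z
  pv : ∀ i → IsPathVertex (v i)

-- One orientation of each edge.
data HE {k r s} : HV k r s → HV k r s → Set where
  xx   : ∀ i j → i ≢ j → HE (x i) (x j)
  xp   : ∀ i p → IsPathVertex p → HE (x i) p
  -- the path u_1 … u_k z v_k … v_1
  uu   : ∀ i j → suc (toℕ i) ≡ toℕ j → HE (u i) (u j)
  uz   : ∀ i → suc (toℕ i) ≡ k → HE (u i) z
  zv   : ∀ i → suc (toℕ i) ≡ k → HE z (v i)
  vv   : ∀ i j → suc (toℕ i) ≡ toℕ j → HE (v j) (v i)
  cux  : ∀ i c → HE (cu i c) (x i)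
  cuu  : ∀ i c → HE (cu i c) (u i)
  cucu : ∀ i c c' → c ≢ c' → HE (cu i c) (cu i c')
  cvx  : ∀ j c i → toℕ j ≡ toℕ i → HE (cv j c) (x i)
  cvv  : ∀ j c i → toℕ j ≡ toℕ i → HE (cv j c) (v i)
  cvcv : ∀ j c c' → c ≢ c' → HE (cv j c) (cv j c')

HAdj : ∀ {k r s} → HV k r s → HV k r s → Set
HAdj a b = HE a b ⊎ HE b a

-- Take a cycle of length at least 4.  If it passes through a new vertex t of
-- a pasted clique, the two cycle-neighbours of t lie in that clique and give a
-- chord at distance 2; one step further out, either a new vertex or the base
-- vertex of the clique (whose neighbours all see the apex x) gives a chord at
-- distance 3, which is odd when the cycle is even.  Otherwise, if it passes
-- through some x, that vertex is adjacent to every other vertex of the cycle.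
-- Otherwise the cycle lies on the path u₁ … z … v₁, which is impossible: at a
-- vertex of maximal position along the path both cycle-neighbours would sit at
-- the position one lower, hence coincide.
module Submission where

open import Data.Nat using (ℕ; zero; suc; _+_; _∸_; _≤_; _<_; _<?_; z≤n; s≤s; z<s; s<s⁻¹; ∣_-_∣; _%_)
open import Data.Nat.Properties
open import Data.Nat.DivMod using (%-distribˡ-+; m%n%n≡m%n)
open import Data.Fin using (Fin; toℕ; fromℕ<; fromℕ; inject₁; inject≤) renaming (zero to fzero; suc to fsuc)
open import Data.Fin.Properties using (toℕ<n; toℕ-fromℕ<; toℕ-fromℕ; toℕ-inject₁; toℕ-inject≤; toℕ-injective; any?)
open import Data.List using (allFin)
open import Data.List.Extrema.Nat using (argmax; f[xs]≤f[argmax])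
open import Data.List.Membership.Propositional.Properties using (∈-allFin)
import Data.List.Relation.Unary.All as All
open import Data.Product using (Σ; ∃; _×_; _,_; proj₁; proj₂)
open import Data.Sum using (_⊎_; inj₁; inj₂; [_,_]; swap)
open import Data.Empty using (⊥-elim)
open import Relation.Binary.Definitions using (Symmetric)
open import Relation.Binary.PropositionalEquality using (_≡_; _≢_; refl; sym; trans; cong; subst; ≢-sym; module ≡-Reasoning)
open import Relation.Nullary using (¬_; yes; no)
open import Relation.Unary using (Decidable)
open import Defs

-- Distances along a cycle

Ahead : (m d a c : ℕ) → Set
Ahead m d a c = c ≡ a + d ⊎ c + m ≡ a + d

ahead-refl : ∀ {m a} → Ahead m 0 a a
ahead-refl {a = a} = inj₁ (sym (+-identityʳ a))

ahead-suc : ∀ {m d a b c} → a < m → suc d < m → Ahead m d a b →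
            (suc b ≡ c ⊎ (suc b ≡ m × c ≡ 0)) → Ahead m (suc d) a c
ahead-suc {d = d} {a} _ _ (inj₁ refl) (inj₁ refl) = inj₁ (sym (+-suc a d))
ahead-suc {d = d} {a} _ _ (inj₁ refl) (inj₂ (b+1≡m , refl)) =
  inj₂ (trans (sym b+1≡m) (sym (+-suc a d)))
ahead-suc {d = d} {a} _ _ (inj₂ wrap) (inj₁ refl) =
  inj₂ (trans (cong suc wrap) (sym (+-suc a d)))
ahead-suc {m} {d} {a} a<m d+1<m (inj₂ wrap) (inj₂ (b+1≡m , _)) =
  ⊥-elim (<⇒≱ a+d+1<a+d+3 (subst (suc a + suc (suc d) ≤_) m+m≡a+d+1 (+-mono-≤ a<m d+1<m)))
  where
    m+m≡a+d+1 : m + m ≡ suc (a + d)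
    m+m≡a+d+1 = trans (cong (_+ m) (sym b+1≡m)) (cong suc wrap)
    a+d+1<a+d+3 : suc (a + d) < suc a + suc (suc d)
    a+d+1<a+d+3 = s≤s (≤-trans (≤-reflexive (sym (+-suc a d))) (+-monoʳ-≤ a (n≤1+n (suc d))))

ahead-unique : ∀ {m d e a c} → d < m → e < m → Ahead m d a c → Ahead m e a c → d ≡ e
ahead-unique {a = a} _ _ (inj₁ p) (inj₁ q) = +-cancelˡ-≡ a _ _ (trans (sym p) q)
ahead-unique {a = a} _ _ (inj₂ p) (inj₂ q) = +-cancelˡ-≡ a _ _ (trans (sym p) q)
ahead-unique _ e<m (inj₁ p) (inj₂ q) = ⊥-elim (no-double-wrap e<m p q)
  where
    no-double-wrap : ∀ {m d e a c} → e < m → c ≡ a + d → c + m ≢ a + e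
    no-double-wrap {m} {d} {e} {a} e<m refl q = <⇒≱ e<m (subst (m ≤_) (sym e≡d+m) (m≤n+m m d))
      where
        e≡d+m : e ≡ d + m
        e≡d+m = +-cancelˡ-≡ a e (d + m) (trans (sym q) (+-assoc a d m))
ahead-unique d<m e<m (inj₂ p) (inj₁ q) = sym (ahead-unique e<m d<m (inj₁ q) (inj₂ p))

ahead-wrap : ∀ {m d a c} → d ≤ m → c + m ≡ a + d → a ≡ c + (m ∸ d)
ahead-wrap {m} {d} {a} {c} d≤m wrap = +-cancelʳ-≡ d a (c + (m ∸ d)) (begin
  a + d             ≡⟨ sym wrap ⟩
  c + m             ≡⟨ cong (c +_) (sym (m∸n+n≡m d≤m)) ⟩
  c + (m ∸ d + d)   ≡⟨ sym (+-assoc c (m ∸ d) d) ⟩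
  c + (m ∸ d) + d   ∎)
  where open ≡-Reasoning

ahead-reverse : ∀ {m d a c} → d ≤ m → Ahead m d a c → Ahead m (m ∸ d) c a
ahead-reverse {m} {d} {a} d≤m (inj₁ refl) = inj₂ (begin
  a + m               ≡⟨ cong (a +_) (sym (m+[n∸m]≡n d≤m)) ⟩
  a + (d + (m ∸ d))   ≡⟨ sym (+-assoc a d (m ∸ d)) ⟩
  a + d + (m ∸ d)     ∎)
  where open ≡-Reasoning
ahead-reverse d≤m (inj₂ wrap) = inj₁ (ahead-wrap d≤m wrap)

ahead⇒∣-∣ : ∀ {m d a c} → d ≤ m → Ahead m d a c → ∣ a - c ∣ ≡ d ⊎ ∣ a - c ∣ ≡ m ∸ d
ahead⇒∣-∣ {d = d} {a} _ (inj₁ refl) = inj₁ (∣m-m+n∣≡n a d)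
ahead⇒∣-∣ {m} {d} {a} {c} d≤m (inj₂ wrap) = inj₂ (begin
  ∣ a - c ∣               ≡⟨ ∣-∣-comm a c ⟩
  ∣ c - a ∣               ≡⟨ cong (∣ c -_∣) (ahead-wrap d≤m wrap) ⟩
  ∣ c - c + (m ∸ d) ∣     ≡⟨ ∣m-m+n∣≡n c (m ∸ d) ⟩
  m ∸ d                   ∎)
  where open ≡-Reasoning

[m∸n]%2≡[m+n]%2 : ∀ m n → n ≤ m → (m ∸ n) % 2 ≡ (m + n) % 2
[m∸n]%2≡[m+n]%2 m       zero    _         = cong (_% 2) (sym (+-identityʳ m))
[m∸n]%2≡[m+n]%2 (suc m) (suc n) (s≤s n≤m) =
  trans ([m∸n]%2≡[m+n]%2 m n n≤m) (cong (_% 2) (sym (cong suc (+-suc m n))))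

[m+n]%2≡n%2 : ∀ m n → m % 2 ≡ 0 → (m + n) % 2 ≡ n % 2
[m+n]%2≡n%2 m n m-even = begin
  (m + n) % 2               ≡⟨ %-distribˡ-+ m n 2 ⟩
  (m % 2 + n % 2) % 2       ≡⟨ cong (λ t → (t + n % 2) % 2) m-even ⟩
  n % 2 % 2                 ≡⟨ m%n%n≡m%n n 2 ⟩
  n % 2                     ∎
  where open ≡-Reasoning

ahead-parity : ∀ {m d a c} → m % 2 ≡ 0 → d ≤ m → Ahead m d a c → ∣ a - c ∣ % 2 ≡ d % 2
ahead-parity {m} {d} m-even d≤m ahead with ahead⇒∣-∣ d≤m ahead
... | inj₁ ∣a-c∣≡d   = cong (_% 2) ∣a-c∣≡d
... | inj₂ ∣a-c∣≡m-d =
  trans (cong (_% 2) ∣a-c∣≡m-d) (trans ([m∸n]%2≡[m+n]%2 m d d≤m) ([m+n]%2≡n%2 m d m-even))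

Steps : (m d : ℕ) → Fin m → Fin m → Set
Steps m d i j = Ahead m d (toℕ i) (toℕ j)

cycNb⇒steps : ∀ {m} {i j : Fin m} → CycNb m i j → Steps m 1 i j
cycNb⇒steps {i = i} (inj₁ e) = inj₁ (trans (sym e) (+-comm 1 (toℕ i)))
cycNb⇒steps {m} {i} (inj₂ (e , j≡0)) =
  inj₂ (trans (cong (_+ m) j≡0) (trans (sym e) (+-comm 1 (toℕ i))))

steps-suc : ∀ {m d} {i j l : Fin m} → suc d < m → Steps m d i j → CycNb m j l → Steps m (suc d) i l
steps-suc {i = i} = ahead-suc (toℕ<n i)

steps-2 : ∀ {m} {a b c : Fin m} → 2 < m → CycNb m a b → CycNb m b c → Steps m 2 a c
steps-2 2<m ab bc = steps-suc 2<m (cycNb⇒steps ab) bc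

steps-3 : ∀ {m} {a b c e : Fin m} → 3 < m → CycNb m a b → CycNb m b c → CycNb m c e → Steps m 3 a e
steps-3 3<m ab bc ce = steps-suc 3<m (steps-2 (<-trans (n<1+n 2) 3<m) ab bc) ce

next : ∀ {m} (i : Fin m) → Σ (Fin m) (CycNb m i)
next {m} i with suc (toℕ i) <? m
... | yes i+1<m = fromℕ< i+1<m , inj₁ (sym (toℕ-fromℕ< i+1<m))
next {suc m} i | no i+1≮m = fzero , inj₂ (≤-antisym (toℕ<n i) (≮⇒≥ i+1≮m) , refl)

prev : ∀ {m} (i : Fin m) → Σ (Fin m) (λ j → CycNb m j i)
prev {suc m} fzero    = fromℕ m , inj₂ (cong suc (toℕ-fromℕ m) , refl)
prev {suc m} (fsuc i) = inject₁ i , inj₁ (cong suc (toℕ-inject₁ i))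

walk : ∀ {m} d → d < m → (i : Fin m) → Σ (Fin m) (Steps m d i)
walk zero    _      i = i , ahead-refl
walk (suc d) d+1<m i with walk d (<-trans (n<1+n d) d+1<m) i
... | j , i→j with next j
... | l , j→l = l , steps-suc d+1<m i→j j→l

steps⇒≢ : ∀ {m d} {i j : Fin m} → 0 < d → d < m → Steps m d i j → i ≢ j
steps⇒≢ 0<d d<m i→j refl = <⇒≢ 0<d (ahead-unique (<-trans 0<d d<m) d<m ahead-refl i→j)

steps⇒¬cycNb : ∀ {m d} {i j : Fin m} → 1 < d → d < m → Steps m d i j → ¬ CycNb m i j
steps⇒¬cycNb 1<d d<m i→j nb = <⇒≢ 1<d (ahead-unique (<-trans 1<d d<m) d<m (cycNb⇒steps nb) i→j)

steps⇒¬cycNb˘ : ∀ {m d} {i j : Fin m} → suc d < m → Steps m d i j → ¬ CycNb m j i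
steps⇒¬cycNb˘ {suc m} {d} d+1<m i→j nb =
  <⇒≢ (s<s⁻¹ d+1<m) (sym (ahead-unique ≤-refl (<-trans (n<1+n d) d+1<m)
                           (ahead-reverse (s≤s z≤n) (cycNb⇒steps nb)) i→j))

-- Chords of cycles in a symmetric graph

maximiser : ∀ {n} → Fin n → (h : Fin n → ℕ) → Σ (Fin n) λ p → ∀ q → h q ≤ h p
maximiser {n} i₀ h =
  argmax h i₀ (allFin n) , λ q → All.lookup (f[xs]≤f[argmax] i₀ (allFin n)) (∈-allFin q)

module Graph {V : Set} (Adj : V → V → Set) (Adj-sym : Symmetric Adj) where

  -- Abstracts a clique pasted on a heavy edge x u: apex x, base u, and the
  -- new vertices as interior.
  record PendantClique : Set₁ where
    field
      apex base       : V
      Member Interior : V → Set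
      interior-nbr    : ∀ {w w′} → Interior w → Adj w w′ → Member w′
      member-adj      : ∀ {w w′} → Member w → Member w′ → w ≢ w′ → Adj w w′
      base-nbr        : ∀ {w} → Adj base w → w ≢ apex → Adj w apex
      member-cases    : ∀ {w} → Member w → w ≡ apex ⊎ w ≡ base ⊎ Interior w

  module _ (C : PendantClique) where
    open PendantClique C

    interior-nbrs-adj : ∀ {a t b} → Interior t → Adj a t → Adj t b → a ≢ b → Adj a b
    interior-nbrs-adj int at tb = member-adj (interior-nbr int (Adj-sym at)) (interior-nbr int tb)

    cross-adj : ∀ {a a′ b b′} → Member a → Member b → a ≢ b →
                Adj a′ a → a′ ≢ b → Adj b b′ → b′ ≢ a → Adj a′ b ⊎ Adj a b′
    cross-adj ma mb a≢b a′a a′≢b bb′ b′≢a with member-cases ma | member-cases mb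
    ... | inj₂ (inj₂ ia) | _              = inj₁ (member-adj (interior-nbr ia (Adj-sym a′a)) mb a′≢b)
    ... | _              | inj₂ (inj₂ ib) = inj₂ (member-adj ma (interior-nbr ib bb′) (≢-sym b′≢a))
    ... | inj₁ refl      | inj₁ refl      = ⊥-elim (a≢b refl)
    ... | inj₁ refl      | inj₂ (inj₁ refl) = inj₂ (Adj-sym (base-nbr bb′ b′≢a))
    ... | inj₂ (inj₁ refl) | inj₁ refl    = inj₁ (base-nbr (Adj-sym a′a) a′≢b)
    ... | inj₂ (inj₁ refl) | inj₂ (inj₁ refl) = ⊥-elim (a≢b refl)

  record PathLayout (P : V → Set) : Set where
    field
      pos           : V → ℕ
      pos-injective : ∀ {a b} → P a → P b → pos a ≡ pos b → a ≡ b
      pos-adjacent  : ∀ {a b} → P a → P b → Adj a b → pos b ≡ suc (pos a) ⊎ pos a ≡ suc (pos b)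

  data Anchored {m : ℕ} (f : Fin m → V) : Set₁ where
    through-pendant : (C : PendantClique) (t : Fin m) → PendantClique.Interior C (f t) → Anchored f
    through-hub     : (p : Fin m) → (∀ q → p ≢ q → Adj (f p) (f q)) → Anchored f

  module Cycle {m : ℕ} {f : Fin m → V} (cyc : IsCycle Adj m f) where

    f-≢ : ∀ {i j} → i ≢ j → f i ≢ f j
    f-≢ i≢j fi≡fj = i≢j (proj₁ cyc fi≡fj)

    edge : ∀ {i j} → CycNb m i j → Adj (f i) (f j)
    edge = proj₂ cyc _ _

    ChordAt : ℕ → Set
    ChordAt d = Σ (Fin m) λ i → Σ (Fin m) λ j → Steps m d i j × Adj (f i) (f j)

    steps⇒chord : ∀ {d i j} → 2 ≤ d → suc d < m → Steps m d i j → Adj (f i) (f j) → IsChord Adj m f i j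
    steps⇒chord {d} 2≤d d+1<m i→j fi~fj =
      steps⇒≢ (<-trans z<s 2≤d) d<m i→j , steps⇒¬cycNb 2≤d d<m i→j , steps⇒¬cycNb˘ d+1<m i→j , fi~fj
      where
        d<m : d < m
        d<m = <-trans (n<1+n d) d+1<m

    hub⇒chordAt : ∀ {d} → 0 < d → d < m → (p : Fin m) → (∀ q → p ≢ q → Adj (f p) (f q)) → ChordAt d
    hub⇒chordAt {d} 0<d d<m p hub with walk d d<m p
    ... | q , p→q = p , q , p→q , hub q (steps⇒≢ 0<d d<m p→q)

    pendant⇒chordAt-2 : 2 < m → (C : PendantClique) → ∀ {t} → PendantClique.Interior C (f t) → ChordAt 2
    pendant⇒chordAt-2 2<m C {t} int with prev t | next t
    ... | a , at | b , tb = a , b , a→b , interior-nbrs-adj C int (edge at) (edge tb) (f-≢ (steps⇒≢ z<s 2<m a→b))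
      where
        a→b : Steps m 2 a b
        a→b = steps-2 2<m at tb

    pendant⇒chordAt-3 : 3 < m → (C : PendantClique) → ∀ {t} → PendantClique.Interior C (f t) → ChordAt 3
    pendant⇒chordAt-3 3<m C {t} int with prev t | next t
    ... | a₁ , a₁t | b₁ , tb₁ with prev a₁ | next b₁
    ... | a₂ , a₂a₁ | b₂ , b₁b₂ =
      [ (λ a₂~b₁ → a₂ , b₁ , a₂→b₁ , a₂~b₁) , (λ a₁~b₂ → a₁ , b₂ , a₁→b₂ , a₁~b₂) ]
        (cross-adj C (interior-nbr int (Adj-sym (edge a₁t))) (interior-nbr int (edge tb₁))
                   (f-≢ (steps⇒≢ z<s 2<m a₁→b₁))
                   (edge a₂a₁) (f-≢ (steps⇒≢ z<s 3<m a₂→b₁))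
                   (edge b₁b₂) (f-≢ (≢-sym (steps⇒≢ z<s 3<m a₁→b₂))))
      where
        open PendantClique C using (interior-nbr)
        2<m : 2 < m
        2<m = <-trans (n<1+n 2) 3<m
        a₁→b₁ : Steps m 2 a₁ b₁
        a₁→b₁ = steps-2 2<m a₁t tb₁
        a₂→b₁ : Steps m 3 a₂ b₁
        a₂→b₁ = steps-3 3<m a₂a₁ a₁t tb₁
        a₁→b₂ : Steps m 3 a₁ b₂
        a₁→b₂ = steps-3 3<m a₁t tb₁ b₁b₂

    anchored⇒chordAt-2 : 2 < m → Anchored f → ChordAt 2
    anchored⇒chordAt-2 2<m (through-pendant C t int) = pendant⇒chordAt-2 2<m C int
    anchored⇒chordAt-2 2<m (through-hub p hub)       = hub⇒chordAt z<s 2<m p hub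

    anchored⇒chordAt-3 : 3 < m → Anchored f → ChordAt 3
    anchored⇒chordAt-3 3<m (through-pendant C t int) = pendant⇒chordAt-3 3<m C int
    anchored⇒chordAt-3 3<m (through-hub p hub)       = hub⇒chordAt z<s 3<m p hub

    cycle-not-within-path : ∀ {P} → PathLayout P → 2 < m → ¬ (∀ i → P (f i))
    cycle-not-within-path {P} layout 2<m on-path with maximiser (fromℕ< (<-trans z<s 2<m)) (λ i → PathLayout.pos layout (f i))
    ... | p , pos≤ with prev p | next p
    ... | a , ap | b , pb =
      steps⇒≢ z<s 2<m a→b (proj₁ cyc (pos-injective (on-path a) (on-path b)
        (suc-injective (trans (sym (below-max (edge ap))) (below-max (Adj-sym (edge pb)))))))
      where
        open PathLayout layout
        a→b : Steps m 2 a b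
        a→b = steps-2 2<m ap pb
        below-max : ∀ {q} → Adj (f q) (f p) → pos (f p) ≡ suc (pos (f q))
        below-max {q} q~p with pos-adjacent (on-path q) (on-path p) q~p
        ... | inj₁ up   = up
        ... | inj₂ down = ⊥-elim (1+n≰n (subst (_≤ pos (f p)) down (pos≤ q)))

  anchored⇒stronglyChordal :
    (∀ {m} {f : Fin m → V} → 3 < m → IsCycle Adj m f → Anchored f) → StronglyChordal Adj
  anchored⇒stronglyChordal anchored = chordal , odd-chord
    where
      chordal : Chordal Adj
      chordal (m , f , 3<m , cyc , chordless)
        with Cycle.anchored⇒chordAt-2 cyc (<-trans (n<1+n 2) 3<m) (anchored 3<m cyc)
      ... | i , j , i→j , fi~fj = chordless i j (Cycle.steps⇒chord cyc ≤-refl 3<m i→j fi~fj)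

      odd-chord : ∀ m (f : Fin m → V) → 6 ≤ m → m % 2 ≡ 0 → IsCycle Adj m f →
                  Σ (Fin m) λ i → Σ (Fin m) λ j → IsOddChord Adj m f i j
      odd-chord m f 5<m m-even cyc = odd (Cycle.anchored⇒chordAt-3 cyc 3<m (anchored 3<m cyc))
        where
          4<m : 4 < m
          4<m = <-trans (n<1+n 4) 5<m
          3<m : 3 < m
          3<m = <-trans (n<1+n 3) 4<m
          odd : Cycle.ChordAt cyc 3 → Σ (Fin m) λ i → Σ (Fin m) λ j → IsOddChord Adj m f i j
          odd (i , j , i→j , fi~fj) =
            i , j , Cycle.steps⇒chord cyc (n≤1+n 2) 4<m i→j fi~fj , ahead-parity m-even (<⇒≤ 3<m) i→j

-- The graphs of H_k

module Hk (k : ℕ) (r : Fin k → ℕ) (s : Fin (k ∸ 1) → ℕ) where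

  V : Set
  V = HV k r s

  Adj : V → V → Set
  Adj = HAdj {k} {r} {s}

  Adj-sym : Symmetric Adj
  Adj-sym = swap

  open Graph Adj Adj-sym

  data PastedU (b : Fin k) : V → Set where
    member-x   : PastedU b (x b)
    member-u   : PastedU b (u b)
    member-new : ∀ c → PastedU b (cu b c)

  data NewU (b : Fin k) : V → Set where
    new : ∀ c → NewU b (cu b c)

  newU-nbr : ∀ {b w w′} → NewU b w → Adj w w′ → PastedU b w′
  newU-nbr (new c) (inj₁ (cux _ _))         = member-x
  newU-nbr (new c) (inj₁ (cuu _ _))         = member-u
  newU-nbr (new c) (inj₁ (cucu _ _ c′ _))   = member-new c′
  newU-nbr (new c) (inj₂ (xp _ _ ()))
  newU-nbr (new c) (inj₂ (cucu _ c′ _ _))   = member-new c′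

  pastedU-adj : ∀ {b w w′} → PastedU b w → PastedU b w′ → w ≢ w′ → Adj w w′
  pastedU-adj member-x       member-x        x≢x = ⊥-elim (x≢x refl)
  pastedU-adj {b} member-x   member-u        _   = inj₁ (xp b (u b) (pu b))
  pastedU-adj {b} member-x   (member-new c)  _   = inj₂ (cux b c)
  pastedU-adj {b} member-u   member-x        _   = inj₂ (xp b (u b) (pu b))
  pastedU-adj member-u       member-u        u≢u = ⊥-elim (u≢u refl)
  pastedU-adj {b} member-u   (member-new c)  _   = inj₂ (cuu b c)
  pastedU-adj {b} (member-new c) member-x    _   = inj₁ (cux b c)
  pastedU-adj {b} (member-new c) member-u    _   = inj₁ (cuu b c)
  pastedU-adj {b} (member-new c) (member-new c′) c≢c′ = inj₁ (cucu b c c′ (λ c≡c′ → c≢c′ (cong (cu b) c≡c′)))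

  u-nbr-adj-x : ∀ {b w} → Adj (u b) w → w ≢ x b → Adj w (x b)
  u-nbr-adj-x {b} (inj₁ (uu _ j _)) _   = inj₂ (xp b (u j) (pu j))
  u-nbr-adj-x {b} (inj₁ (uz _ _))   _   = inj₂ (xp b z pz)
  u-nbr-adj-x {b} (inj₂ (xp i _ _)) w≢x = inj₁ (xx i b (λ i≡b → w≢x (cong x i≡b)))
  u-nbr-adj-x {b} (inj₂ (uu i _ _)) _   = inj₂ (xp b (u i) (pu i))
  u-nbr-adj-x {b} (inj₂ (cuu _ c))  _   = inj₁ (cux b c)

  pastedU-cases : ∀ {b w} → PastedU b w → w ≡ x b ⊎ w ≡ u b ⊎ NewU b w
  pastedU-cases member-x       = inj₁ refl
  pastedU-cases member-u       = inj₂ (inj₁ refl)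
  pastedU-cases (member-new c) = inj₂ (inj₂ (new c))

  pastedU : Fin k → PendantClique
  pastedU b = record
    { apex = x b ; base = u b ; Member = PastedU b ; Interior = NewU b
    ; interior-nbr = newU-nbr ; member-adj = pastedU-adj
    ; base-nbr = u-nbr-adj-x ; member-cases = pastedU-cases }

  -- The heavy edge x_{j+1} v_{j+1} for j : Fin (k ∸ 1) has its ends indexed by ι j : Fin k.
  ι : Fin (k ∸ 1) → Fin k
  ι j = inject≤ j (m∸n≤m k 1)

  ι-toℕ : ∀ j → toℕ j ≡ toℕ (ι j)
  ι-toℕ j = sym (toℕ-inject≤ j (m∸n≤m k 1))

  ι-unique : ∀ j i → toℕ j ≡ toℕ i → i ≡ ι j
  ι-unique j i j≡i = toℕ-injective (trans (sym j≡i) (ι-toℕ j))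

  data PastedV (j : Fin (k ∸ 1)) : V → Set where
    member-x   : PastedV j (x (ι j))
    member-v   : PastedV j (v (ι j))
    member-new : ∀ c → PastedV j (cv j c)

  data NewV (j : Fin (k ∸ 1)) : V → Set where
    new : ∀ c → NewV j (cv j c)

  newV-nbr : ∀ {j w w′} → NewV j w → Adj w w′ → PastedV j w′
  newV-nbr {j} (new c) (inj₁ (cvx _ _ i j≡i)) with ι-unique j i j≡i
  ... | refl = member-x
  newV-nbr {j} (new c) (inj₁ (cvv _ _ i j≡i)) with ι-unique j i j≡i
  ... | refl = member-v
  newV-nbr (new c) (inj₁ (cvcv _ _ c′ _))   = member-new c′
  newV-nbr (new c) (inj₂ (xp _ _ ()))
  newV-nbr (new c) (inj₂ (cvcv _ c′ _ _))   = member-new c′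

  pastedV-adj : ∀ {j w w′} → PastedV j w → PastedV j w′ → w ≢ w′ → Adj w w′
  pastedV-adj member-x       member-x        x≢x = ⊥-elim (x≢x refl)
  pastedV-adj {j} member-x   member-v        _   = inj₁ (xp (ι j) (v (ι j)) (pv (ι j)))
  pastedV-adj {j} member-x   (member-new c)  _   = inj₂ (cvx j c (ι j) (ι-toℕ j))
  pastedV-adj {j} member-v   member-x        _   = inj₂ (xp (ι j) (v (ι j)) (pv (ι j)))
  pastedV-adj member-v       member-v        v≢v = ⊥-elim (v≢v refl)
  pastedV-adj {j} member-v   (member-new c)  _   = inj₂ (cvv j c (ι j) (ι-toℕ j))
  pastedV-adj {j} (member-new c) member-x    _   = inj₁ (cvx j c (ι j) (ι-toℕ j))
  pastedV-adj {j} (member-new c) member-v    _   = inj₁ (cvv j c (ι j) (ι-toℕ j))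
  pastedV-adj {j} (member-new c) (member-new c′) c≢c′ = inj₁ (cvcv j c c′ (λ c≡c′ → c≢c′ (cong (cv j) c≡c′)))

  v-nbr-adj-x : ∀ {j w} → Adj (v (ι j)) w → w ≢ x (ι j) → Adj w (x (ι j))
  v-nbr-adj-x {j} (inj₁ (vv i _ _))    _   = inj₂ (xp (ι j) (v i) (pv i))
  v-nbr-adj-x {j} (inj₂ (xp i _ _))    w≢x = inj₁ (xx i (ι j) (λ i≡ιj → w≢x (cong x i≡ιj)))
  v-nbr-adj-x {j} (inj₂ (zv _ _))      _   = inj₂ (xp (ι j) z pz)
  v-nbr-adj-x {j} (inj₂ (vv _ i _))    _   = inj₂ (xp (ι j) (v i) (pv i))
  v-nbr-adj-x {j} (inj₂ (cvv j′ c _ e)) _  = inj₁ (cvx j′ c (ι j) e)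

  pastedV-cases : ∀ {j w} → PastedV j w → w ≡ x (ι j) ⊎ w ≡ v (ι j) ⊎ NewV j w
  pastedV-cases member-x       = inj₁ refl
  pastedV-cases member-v       = inj₂ (inj₁ refl)
  pastedV-cases (member-new c) = inj₂ (inj₂ (new c))

  pastedV : Fin (k ∸ 1) → PendantClique
  pastedV j = record
    { apex = x (ι j) ; base = v (ι j) ; Member = PastedV j ; Interior = NewV j
    ; interior-nbr = newV-nbr ; member-adj = pastedV-adj
    ; base-nbr = v-nbr-adj-x ; member-cases = pastedV-cases }

  pos : V → ℕ
  pos (u i) = toℕ i
  pos z     = k
  pos (v i) = k + (k ∸ toℕ i)
  pos _     = 0

  pos-v+i : ∀ i → pos (v i) + toℕ i ≡ k + k
  pos-v+i i = trans (+-assoc k (k ∸ toℕ i) (toℕ i)) (cong (k +_) (m∸n+n≡m (<⇒≤ (toℕ<n i))))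

  k<pos-v : ∀ i → k < pos (v i)
  k<pos-v i = m<m+n k (m<n⇒0<n∸m (toℕ<n i))

  path-step : ∀ {a b} → IsPathVertex a → HE a b → pos b ≡ suc (pos a)
  path-step (pu _) (uu _ _ i+1≡j) = sym i+1≡j
  path-step (pu _) (uz _ i+1≡k)   = sym i+1≡k
  path-step pz (zv i i+1≡k) = +-cancelʳ-≡ (toℕ i) (pos (v i)) (suc k) (begin
    pos (v i) + toℕ i   ≡⟨ pos-v+i i ⟩
    k + k               ≡⟨ cong (k +_) (sym i+1≡k) ⟩
    k + suc (toℕ i)     ≡⟨ +-suc k (toℕ i) ⟩
    suc k + toℕ i       ∎)
    where open ≡-Reasoning
  path-step (pv _) (vv i j i+1≡j) = +-cancelʳ-≡ (toℕ i) (pos (v i)) (suc (pos (v j))) (begin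
    pos (v i) + toℕ i         ≡⟨ pos-v+i i ⟩
    k + k                     ≡⟨ sym (pos-v+i j) ⟩
    pos (v j) + toℕ j         ≡⟨ cong (pos (v j) +_) (sym i+1≡j) ⟩
    pos (v j) + suc (toℕ i)   ≡⟨ +-suc (pos (v j)) (toℕ i) ⟩
    suc (pos (v j)) + toℕ i   ∎)
    where open ≡-Reasoning

  pos-injective : ∀ {a b} → IsPathVertex a → IsPathVertex b → pos a ≡ pos b → a ≡ b
  pos-injective (pu i) (pu j) e = cong u (toℕ-injective e)
  pos-injective (pu i) pz     e = ⊥-elim (<⇒≢ (toℕ<n i) e)
  pos-injective (pu i) (pv j) e = ⊥-elim (<⇒≢ (<-trans (toℕ<n i) (k<pos-v j)) e)
  pos-injective pz     (pu j) e = ⊥-elim (<⇒≢ (toℕ<n j) (sym e))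
  pos-injective pz     pz     _ = refl
  pos-injective pz     (pv j) e = ⊥-elim (<⇒≢ (k<pos-v j) e)
  pos-injective (pv i) (pu j) e = ⊥-elim (<⇒≢ (<-trans (toℕ<n j) (k<pos-v i)) (sym e))
  pos-injective (pv i) pz     e = ⊥-elim (<⇒≢ (k<pos-v i) (sym e))
  pos-injective (pv i) (pv j) e = cong v (toℕ-injective (+-cancelˡ-≡ (pos (v i)) (toℕ i) (toℕ j)
    (trans (pos-v+i i) (trans (sym (pos-v+i j)) (cong (_+ toℕ j) (sym e))))))

  path-layout : PathLayout IsPathVertex
  path-layout = record
    { pos = pos
    ; pos-injective = pos-injective
    ; pos-adjacent = λ { pa _ (inj₁ ab) → inj₁ (path-step pa ab) ; _ pb (inj₂ ba) → inj₂ (path-step pb ba) } }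

  data New : V → Set where
    new-u : ∀ b c → New (cu b c)
    new-v : ∀ j c → New (cv j c)

  new? : Decidable New
  new? (x _)    = no λ ()
  new? (u _)    = no λ ()
  new? z        = no λ ()
  new? (v _)    = no λ ()
  new? (cu b c) = yes (new-u b c)
  new? (cv j c) = yes (new-v j c)

  new⇒interior : ∀ {w} → New w → Σ PendantClique λ C → PendantClique.Interior C w
  new⇒interior (new-u b c) = pastedU b , new c
  new⇒interior (new-v j c) = pastedV j , new c

  IsX : V → Set
  IsX w = ∃ λ a → w ≡ x a

  x? : Decidable IsX
  x? (x a)    = yes (a , refl)
  x? (u _)    = no λ ()
  x? z        = no λ ()
  x? (v _)    = no λ ()
  x? (cu _ _) = no λ ()
  x? (cv _ _) = no λ ()

  x-adj : ∀ a {w} → w ≢ x a → ¬ New w → Adj (x a) w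
  x-adj a {x i}    w≢x _    = inj₁ (xx a i (λ a≡i → w≢x (cong x (sym a≡i))))
  x-adj a {u i}    _   _    = inj₁ (xp a (u i) (pu i))
  x-adj a {z}      _   _    = inj₁ (xp a z pz)
  x-adj a {v i}    _   _    = inj₁ (xp a (v i) (pv i))
  x-adj a {cu b c} _   ¬new = ⊥-elim (¬new (new-u b c))
  x-adj a {cv j c} _   ¬new = ⊥-elim (¬new (new-v j c))

  path-vertex : ∀ {w} → ¬ New w → ¬ IsX w → IsPathVertex w
  path-vertex {x a}    _    ¬x = ⊥-elim (¬x (a , refl))
  path-vertex {u i}    _    _  = pu i
  path-vertex {z}      _    _  = pz
  path-vertex {v i}    _    _  = pv i
  path-vertex {cu b c} ¬new _  = ⊥-elim (¬new (new-u b c))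
  path-vertex {cv j c} ¬new _  = ⊥-elim (¬new (new-v j c))

  anchored : ∀ {m} {f : Fin m → V} → 2 < m → IsCycle Adj m f → Anchored f
  anchored {m} {f} 2<m cyc with any? (λ i → new? (f i))
  ... | yes (t , new-t) = through-pendant (proj₁ C,int) t (proj₂ C,int)
    where
      C,int : Σ PendantClique λ C → PendantClique.Interior C (f t)
      C,int = new⇒interior new-t
  ... | no no-new with any? (λ i → x? (f i))
  ...   | yes (p , a , fp≡xa) = through-hub p λ q p≢q →
          subst (λ w → Adj w (f q)) (sym fp≡xa)
                (x-adj a (λ fq≡xa → p≢q (proj₁ cyc (trans fp≡xa (sym fq≡xa)))) (λ new-q → no-new (q , new-q)))
  ...   | no no-x = ⊥-elim (Cycle.cycle-not-within-path cyc path-layout 2<m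
                      λ i → path-vertex (λ new-i → no-new (i , new-i)) (λ x-i → no-x (i , x-i)))

lemma2p6 : (k : ℕ) → 3 ≤ k →
    (r : Fin k → ℕ) → (s : Fin (k ∸ 1) → ℕ) →
    (∀ i → 3 ≤ r i) → (∀ j → 3 ≤ s j) →
    StronglyChordal (HAdj {k} {r} {s})
lemma2p6 k _ r s _ _ = anchored⇒stronglyChordal λ 3<m → anchored (<-trans (n<1+n 2) 3<m)
  where
    open Hk k r s using (Adj; Adj-sym; anchored)
    open Graph Adj Adj-sym using (anchored⇒stronglyChordal)
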